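{- Let $G$ be a finite abelian $p$-group of exponent $p^e$ ($e\ge1$), $r_i(G)=\log_p[p^{i-1}G:p^iG]$, $\alpha_p(G)=\big(1+(p-1)\sum_{i=1}^e p^{e-i}r_i(G)\big)/p^e$, and $w_i(l)=\lfloor (l-1)/p^{i-1}\rfloor-\lfloor (l-1)/p^i\rfloor$. Let $k\ge2$ and let $l_1,\dots,l_k$ be integers with $1\le l_j\le p^e-1$. Put $$\varepsilon(l_1,\dots,l_k)=\alpha_p(G)-\frac{1+\sum_{i=1}^e r_i(G)\big(w_i(l_1)+\dots+w_i(l_k)\big)}{l_1+\dots+l_k}.$$ Then $\varepsilon(l_1,\dots,l_k)>1/(2p^e)$. -}

module Defs where

open import Level using (Level; _⊔_)
open import Data.Nat as ℕ using (ℕ; zero; suc; _^_; _∸_; _≤_)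
open import Data.Nat.DivMod using (_/_)
open import Data.Nat.Properties using (m^n≢0)
open import Data.Integer as ℤ using (ℤ; +_)
open import Data.Rational as ℚ using (ℚ)
open import Data.Fin using (Fin)
open import Data.Fin.Properties using (any?)
open import Data.List using (length; filter; allFin)
open import Data.Product using (∃)
open import Relation.Binary.PropositionalEquality using (_≡_)
open import Relation.Binary.Definitions using (Decidable)
open import Relation.Nullary using (¬_)
open import Algebra.Bundles using (AbelianGroup)

-- n · x in an abelian group (written multiplicatively in the stdlib bundle)
module _ {c ℓ : Level} (G : AbelianGroup c ℓ) where
  open AbelianGroup G

  mulN : ℕ → Carrier → Carrier
  mulN zero    x = ε
  mulN (suc n) x = x ∙ mulN n x

record FiniteAbelianGroup (c ℓ : Level) : Set (Level.suc (c ⊔ ℓ)) where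
  field
    abGroup : AbelianGroup c ℓ
  open AbelianGroup abGroup public
  field
    _≟_        : Decidable _≈_
    size       : ℕ
    enum       : Fin size → Carrier
    enum-inj   : ∀ i j → enum i ≈ enum j → i ≡ j
    enum-surj  : ∀ x → ∃ λ i → enum i ≈ x

  inMultiples : ℕ → Fin size → Set _
  inMultiples m j = ∃ λ (k : Fin size) → mulN abGroup m (enum k) ≈ enum j

  inMultiples? : ∀ m j → Relation.Nullary.Dec (inMultiples m j)
  inMultiples? m j = any? (λ k → mulN abGroup m (enum k) ≟ enum j)

  card-mult : ℕ → ℕ
  card-mult m = length (filter (inMultiples? m) (allFin size))

open FiniteAbelianGroup public using (card-mult)

HasExponent : ∀ {c ℓ} → FiniteAbelianGroup c ℓ → ℕ → ℕ → Set (c ⊔ ℓ)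
HasExponent G p e =
  (∀ x → mulN grp (p ^ e) x ≈ ε) × (∃ λ x → ¬ (mulN grp (p ^ (e ∸ 1)) x ≈ ε))
  where
    open FiniteAbelianGroup G renaming (abGroup to grp)
    open import Data.Product using (_×_)

AreRanks : ∀ {c ℓ} → FiniteAbelianGroup c ℓ → ℕ → ℕ → (ℕ → ℕ) → Set
AreRanks G p e r = ∀ i → 1 ≤ i → i ≤ e →
  card-mult G (p ^ (i ∸ 1)) ≡ p ^ r i ℕ.* card-mult G (p ^ i)

fromℕ : ℕ → ℚ
fromℕ n = (+ n) ℚ./ 1

-- 1/n for n ≥ 1 (only ever applied to positive n; value 0 at 0 is junk)
inv : ℕ → ℚ
inv zero    = ℚ.0ℚ
inv (suc n) = (+ 1) ℚ./ suc n

sumFrom1 : ℕ → (ℕ → ℚ) → ℚ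
sumFrom1 zero    f = ℚ.0ℚ
sumFrom1 (suc e) f = sumFrom1 e f ℚ.+ f (suc e)

sumFin : (k : ℕ) → (Fin k → ℚ) → ℚ
sumFin zero    f = ℚ.0ℚ
sumFin (suc k) f = f Fin.zero ℚ.+ sumFin k (λ j → f (Fin.suc j))
  where import Data.Fin as Fin

sumFinℕ : (k : ℕ) → (Fin k → ℕ) → ℕ
sumFinℕ zero    f = 0
sumFinℕ (suc k) f = f Fin.zero ℕ.+ sumFinℕ k (λ j → f (Fin.suc j))
  where import Data.Fin as Fin

alpha : ℕ → ℕ → (ℕ → ℕ) → ℚ
alpha p e r =
  (fromℕ 1 ℚ.+ fromℕ (p ∸ 1) ℚ.* sumFrom1 e (λ i → fromℕ (p ^ (e ∸ i) ℕ.* r i)))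
  ℚ.* inv (p ^ e)

w : (p : ℕ) → .{{_ : ℕ.NonZero p}} → ℕ → ℕ → ℚ
w p i l = (+ ((l ∸ 1) / (p ^ (i ∸ 1))) ℤ.- + ((l ∸ 1) / (p ^ i))) ℚ./ 1
  where instance
          nz1 : ℕ.NonZero (p ^ (i ∸ 1))
          nz1 = m^n≢0 p (i ∸ 1)
          nz2 : ℕ.NonZero (p ^ i)
          nz2 = m^n≢0 p i

epsilon : (p : ℕ) → .{{_ : ℕ.NonZero p}} → ℕ → (ℕ → ℕ) → (k : ℕ) → (Fin k → ℕ) → ℚ
epsilon p e r k l =
  alpha p e r ℚ.-
  (fromℕ 1 ℚ.+ sumFrom1 e (λ i → fromℕ (r i) ℚ.* sumFin k (λ j → w p i (l j))))
  ℚ.* inv (sumFinℕ k l)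

{-# OPTIONS --safe #-}
module Submission where

-- Put q = p^e and L = Σ l_j. Then ε = 1/q − 1/L + Σ_i r_i δ_i with δ_i = (p−1) p^(e−i)/q − W_i/L and
-- W_i = Σ_j w_i(l_j). As w_i telescopes in i, the partial sums S_t = Σ_{i≤t} δ_i equal
-- (k + Σ_j ⌊(l_j−1)/p^t⌋)/L − p^(e−t)/q, which is ≥ 0 because l_j ≤ p^t (1 + ⌊(l_j−1)/p^t⌋).
-- The ranks are non-increasing, since |p^i G|² ≤ |p^(i−1) G| |p^(i+1) G|, and r_e ≥ 1; so Abel summation
-- gives Σ_i r_i δ_i ≥ r_e S_e ≥ S_e ≥ k/L − 1/q. Hence ε ≥ (k−1)/L, which exceeds 1/(2q) as L ≤ k (q−1).

open import Defs
open import Level using (Level)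
open import Data.Nat using (ℕ; NonZero)
open import Data.Fin using (Fin)

module ℕ-Lemmas where
  open import Data.Nat
  open import Data.Nat.Properties
  open import Data.Nat.DivMod using (_/_; _%_; m≡m%n+[m/n]*n; m%n<n)
  open import Data.Nat.Tactic.RingSolver using (solve-∀)
  open import Relation.Binary.PropositionalEquality

  suc[n∸1]≡n : ∀ {n} → 1 ≤ n → suc (n ∸ 1) ≡ n
  suc[n∸1]≡n (s≤s _) = refl

  m<n*[1+m/n] : ∀ m n .{{_ : NonZero n}} → m < n * suc (m / n)
  m<n*[1+m/n] m n = begin-strict
    m                  ≡⟨ m≡m%n+[m/n]*n m n ⟩
    m % n + m / n * n  <⟨ +-monoˡ-< (m / n * n) (m%n<n m n) ⟩
    suc (m / n) * n    ≡⟨ *-comm (suc (m / n)) n ⟩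
    n * suc (m / n)    ∎
    where open ≤-Reasoning

  m*[n∸1]<[m∸1]*[2*n] : ∀ m n → 2 ≤ m → 1 ≤ n → m * (n ∸ 1) < (m ∸ 1) * (2 * n)
  m*[n∸1]<[m∸1]*[2*n] (suc (suc m)) (suc n) (s≤s (s≤s z≤n)) _ =
    ≤-trans (s≤s (m≤m+n ((2 + m) * n) (m * n + 2 * m + 1))) (≤-reflexive (identity m n))
    where identity : ∀ m n → suc ((2 + m) * n + (m * n + 2 * m + 1)) ≡ (1 + m) * (2 * (1 + n))
          identity = solve-∀

  successive-ratios-≤ : ∀ {A B C X Y} → A ≡ X * B → B ≡ Y * C → 1 ≤ B → 1 ≤ C → B * B ≤ A * C → Y ≤ X
  successive-ratios-≤ {A} {B} {C} {X} {Y} refl refl 1≤B 1≤C B²≤AC =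
    *-cancelʳ-≤ Y X (C * B) {{>-nonZero (*-mono-≤ 1≤C 1≤B)}} (subst₂ _≤_ (*-assoc Y C B) AC≡ B²≤AC)
    where AC≡ : X * (Y * C) * C ≡ X * (C * (Y * C))
          AC≡ = trans (*-assoc X (Y * C) C) (cong (X *_) (*-comm (Y * C) C))

  ^-cancelʳ-≤ : ∀ {m x y} → 1 < m → m ^ y ≤ m ^ x → y ≤ x
  ^-cancelʳ-≤ {m} 1<m mʸ≤mˣ = ≮⇒≥ (λ x<y → <⇒≱ (^-monoʳ-< m 1<m x<y) mʸ≤mˣ)

module ℚ-RingSolver where
  open import Level using (0ℓ)
  open import Data.Rational using (0ℚ)
  open import Data.Rational.Properties using (_≟_; +-*-commutativeRing)
  open import Relation.Nullary.Decidable using (dec⇒maybe)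
  open import Tactic.RingSolver.Core.AlmostCommutativeRing using (AlmostCommutativeRing; fromCommutativeRing)

  ℚ-ring : AlmostCommutativeRing 0ℓ 0ℓ
  ℚ-ring = fromCommutativeRing +-*-commutativeRing (λ x → dec⇒maybe (0ℚ ≟ x))

module ℚ-Lemmas where
  open import Data.Nat as ℕ using (ℕ; suc; NonZero; _≤_; _<_)
  import Data.Nat.Properties as ℕ
  open import Data.Integer as ℤ using (ℤ; +_)
  import Data.Integer.Properties as ℤ
  open import Data.Nat.Coprimality using (1-coprimeTo) renaming (sym to coprime-sym)
  open import Data.Rational hiding (_≤_; _<_; NonZero)
  import Data.Rational as ℚ
  open import Data.Rational.Properties
  import Data.Rational.Unnormalised as ℚᵘ
  import Data.Rational.Unnormalised.Properties as ℚᵘ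
  open import Relation.Binary.PropositionalEquality
  open ℚ-RingSolver
  open import Tactic.RingSolver using (solve-∀)

  fromℤ : ℤ → ℚ
  fromℤ i = i / 1

  fromℤ-normal : ∀ i → fromℤ i ≡ mkℚ i 0 (coprime-sym (1-coprimeTo ℤ.∣ i ∣))
  fromℤ-normal i = ↥p/↧p≡p (mkℚ i 0 _)

  toℚᵘ-fromℤ : ∀ i → toℚᵘ (fromℤ i) ≡ ℚᵘ.mkℚᵘ i 0
  toℚᵘ-fromℤ i = cong toℚᵘ (fromℤ-normal i)

  fromℤ-homo-+ : ∀ i j → fromℤ (i ℤ.+ j) ≡ fromℤ i + fromℤ j
  fromℤ-homo-+ i j = toℚᵘ-injective (begin
    toℚᵘ (fromℤ (i ℤ.+ j))                  ≡⟨ toℚᵘ-fromℤ (i ℤ.+ j) ⟩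
    ℚᵘ.mkℚᵘ (i ℤ.+ j) 0                      ≈⟨ ℚᵘ.*≡* (cong (ℤ._* + 1) (sym (cong₂ ℤ._+_ (ℤ.*-identityʳ i) (ℤ.*-identityʳ j)))) ⟩
    ℚᵘ.mkℚᵘ i 0 ℚᵘ.+ ℚᵘ.mkℚᵘ j 0             ≡⟨ cong₂ ℚᵘ._+_ (toℚᵘ-fromℤ i) (toℚᵘ-fromℤ j) ⟨
    toℚᵘ (fromℤ i) ℚᵘ.+ toℚᵘ (fromℤ j)       ≈⟨ toℚᵘ-homo-+ (fromℤ i) (fromℤ j) ⟨
    toℚᵘ (fromℤ i + fromℤ j)                 ∎)
    where open ℚᵘ.≃-Reasoning

  fromℤ-homo-* : ∀ i j → fromℤ (i ℤ.* j) ≡ fromℤ i * fromℤ j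
  fromℤ-homo-* i j = toℚᵘ-injective (begin
    toℚᵘ (fromℤ (i ℤ.* j))                  ≡⟨ toℚᵘ-fromℤ (i ℤ.* j) ⟩
    ℚᵘ.mkℚᵘ i 0 ℚᵘ.* ℚᵘ.mkℚᵘ j 0             ≡⟨ cong₂ ℚᵘ._*_ (toℚᵘ-fromℤ i) (toℚᵘ-fromℤ j) ⟨
    toℚᵘ (fromℤ i) ℚᵘ.* toℚᵘ (fromℤ j)       ≈⟨ toℚᵘ-homo-* (fromℤ i) (fromℤ j) ⟨
    toℚᵘ (fromℤ i * fromℤ j)                 ∎)
    where open ℚᵘ.≃-Reasoning

  fromℤ-homo‿- : ∀ i → fromℤ (ℤ.- i) ≡ - fromℤ i
  fromℤ-homo‿- i = toℚᵘ-injective (begin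
    toℚᵘ (fromℤ (ℤ.- i))   ≡⟨ toℚᵘ-fromℤ (ℤ.- i) ⟩
    ℚᵘ.- ℚᵘ.mkℚᵘ i 0        ≡⟨ cong ℚᵘ.-_ (toℚᵘ-fromℤ i) ⟨
    ℚᵘ.- toℚᵘ (fromℤ i)     ≈⟨ toℚᵘ-homo‿- (fromℤ i) ⟨
    toℚᵘ (- fromℤ i)        ∎)
    where open ℚᵘ.≃-Reasoning

  fromℤ-homo-sub : ∀ i j → fromℤ (i ℤ.- j) ≡ fromℤ i - fromℤ j
  fromℤ-homo-sub i j = trans (fromℤ-homo-+ i (ℤ.- j)) (cong (_+_ (fromℤ i)) (fromℤ-homo‿- j))

  fromℕ-homo-+ : ∀ m n → fromℕ (m ℕ.+ n) ≡ fromℕ m + fromℕ n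
  fromℕ-homo-+ m n = trans (cong fromℤ (ℤ.pos-+ m n)) (fromℤ-homo-+ (+ m) (+ n))

  fromℕ-homo-* : ∀ m n → fromℕ (m ℕ.* n) ≡ fromℕ m * fromℕ n
  fromℕ-homo-* m n = trans (cong fromℤ (ℤ.pos-* m n)) (fromℤ-homo-* (+ m) (+ n))

  fromℕ-homo-∸ : ∀ {m n} → n ≤ m → fromℕ (m ℕ.∸ n) ≡ fromℕ m - fromℕ n
  fromℕ-homo-∸ {m} {n} n≤m = begin
    fromℤ (+ (m ℕ.∸ n))  ≡⟨ cong fromℤ (ℤ.⊖-≥ n≤m) ⟨
    fromℤ (m ℤ.⊖ n)      ≡⟨ cong fromℤ (ℤ.[+m]-[+n]≡m⊖n m n) ⟨
    fromℤ (+ m ℤ.- + n)  ≡⟨ fromℤ-homo-sub (+ m) (+ n) ⟩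
    fromℕ m - fromℕ n    ∎
    where open ≡-Reasoning

  fromℕ-mono-≤ : ∀ {m n} → m ≤ n → fromℕ m ℚ.≤ fromℕ n
  fromℕ-mono-≤ {m} {n} m≤n rewrite fromℤ-normal (+ m) | fromℤ-normal (+ n) =
    *≤* (ℤ.*-monoʳ-≤-nonNeg (+ 1) (ℤ.+≤+ m≤n))

  fromℕ-mono-< : ∀ {m n} → m < n → fromℕ m ℚ.< fromℕ n
  fromℕ-mono-< {m} {n} m<n rewrite fromℤ-normal (+ m) | fromℤ-normal (+ n) =
    *<* (ℤ.*-monoʳ-<-pos (+ 1) (ℤ.+<+ m<n))

  fromℕ-positive : ∀ n .{{_ : NonZero n}} → Positive (fromℕ n)
  fromℕ-positive (suc n) = positive (fromℕ-mono-< (ℕ.z<s {n}))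

  fromℕ*inv≡1 : ∀ n .{{_ : NonZero n}} → fromℕ n * inv n ≡ 1ℚ
  fromℕ*inv≡1 (suc n) =
    trans (cong₂ _*_ (fromℤ-normal (+ suc n)) (↥p/↧p≡p (mkℚ (+ 1) n (1-coprimeTo (suc n)))))
          (*-inverseʳ (mkℚ (+ suc n) 0 (coprime-sym (1-coprimeTo (suc n)))))

  fromℕ*inv-cancelˡ : ∀ a c d .{{_ : NonZero c}} → fromℕ a * inv c * fromℕ (c ℕ.* d) ≡ fromℕ (a ℕ.* d)
  fromℕ*inv-cancelˡ a c d = begin
    fromℕ a * inv c * fromℕ (c ℕ.* d)         ≡⟨ cong (fromℕ a * inv c *_) (fromℕ-homo-* c d) ⟩
    fromℕ a * inv c * (fromℕ c * fromℕ d)     ≡⟨ rearrange (fromℕ a) (inv c) (fromℕ c) (fromℕ d) ⟩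
    fromℕ a * (fromℕ c * inv c) * fromℕ d     ≡⟨ cong (λ x → fromℕ a * x * fromℕ d) (fromℕ*inv≡1 c) ⟩
    fromℕ a * 1ℚ * fromℕ d                    ≡⟨ cong (_* fromℕ d) (*-identityʳ (fromℕ a)) ⟩
    fromℕ a * fromℕ d                         ≡⟨ fromℕ-homo-* a d ⟨
    fromℕ (a ℕ.* d)                           ∎
    where
    open ≡-Reasoning
    rearrange : ∀ a i c d → a * i * (c * d) ≡ a * (c * i) * d
    rearrange = solve-∀ ℚ-ring

  fromℕ*inv-cancelʳ : ∀ b c d .{{_ : NonZero d}} → fromℕ b * inv d * fromℕ (c ℕ.* d) ≡ fromℕ (b ℕ.* c)
  fromℕ*inv-cancelʳ b c d = trans (cong (λ x → fromℕ b * inv d * fromℕ x) (ℕ.*-comm c d)) (fromℕ*inv-cancelˡ b d c)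

  fromℕ*inv-≤ : ∀ a b c d .{{_ : NonZero c}} .{{_ : NonZero d}} → a ℕ.* d ≤ b ℕ.* c → fromℕ a * inv c ℚ.≤ fromℕ b * inv d
  fromℕ*inv-≤ a b c d ad≤bc = *-cancelʳ-≤-pos (fromℕ (c ℕ.* d)) {{fromℕ-positive (c ℕ.* d) {{ℕ.m*n≢0 c d}}}}
    (subst₂ ℚ._≤_ (sym (fromℕ*inv-cancelˡ a c d)) (sym (fromℕ*inv-cancelʳ b c d)) (fromℕ-mono-≤ ad≤bc))

  fromℕ*inv-< : ∀ a b c d .{{_ : NonZero c}} .{{_ : NonZero d}} → a ℕ.* d < b ℕ.* c → fromℕ a * inv c ℚ.< fromℕ b * inv d
  fromℕ*inv-< a b c d ad<bc = *-cancelʳ-<-nonNeg (fromℕ (c ℕ.* d)) {{pos⇒nonNeg (fromℕ (c ℕ.* d)) {{fromℕ-positive (c ℕ.* d) {{ℕ.m*n≢0 c d}}}}}}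
    (subst₂ ℚ._<_ (sym (fromℕ*inv-cancelˡ a c d)) (sym (fromℕ*inv-cancelʳ b c d)) (fromℕ-mono-< ad<bc))

  p≤q⇒0≤q-p : ∀ {x y} → x ℚ.≤ y → 0ℚ ℚ.≤ y - x
  p≤q⇒0≤q-p {x} {y} x≤y = subst (ℚ._≤ y - x) (+-inverseʳ x) (+-monoˡ-≤ (- x) x≤y)

module Sums where
  open import Data.Nat as ℕ using (ℕ; zero; suc; _∸_; z≤n; s≤s)
  import Data.Nat.Properties as ℕ
  open import Data.Fin using (Fin)
  import Data.Fin as Fin
  open import Data.Rational using (ℚ; _+_; _*_; _-_; _≤_; 0ℚ)
  open import Data.Rational.Properties using (+-inverseʳ; *-zeroʳ; *-distribˡ-+; +-monoˡ-≤; *-monoʳ-≤-nonNeg; ≤-trans; ≤-reflexive; module ≤-Reasoning)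
  import Data.Rational as ℚ
  open import Relation.Binary.PropositionalEquality
  open ℚ-RingSolver
  open import Tactic.RingSolver using (solve-∀)
  open ℚ-Lemmas

  sumFrom1-cong : ∀ t {f g : ℕ → ℚ} → (∀ i → 1 ℕ.≤ i → i ℕ.≤ t → f i ≡ g i) → sumFrom1 t f ≡ sumFrom1 t g
  sumFrom1-cong zero    f≗g = refl
  sumFrom1-cong (suc t) f≗g =
    cong₂ _+_ (sumFrom1-cong t (λ i 1≤i i≤t → f≗g i 1≤i (ℕ.m≤n⇒m≤1+n i≤t))) (f≗g (suc t) (s≤s z≤n) ℕ.≤-refl)

  sumFrom1-linear : ∀ t a b (f g : ℕ → ℚ) → sumFrom1 t (λ i → a * f i - b * g i) ≡ a * sumFrom1 t f - b * sumFrom1 t g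
  sumFrom1-linear zero    a b f g = sym (vanish a b)
    where vanish : ∀ a b → a * 0ℚ - b * 0ℚ ≡ 0ℚ
          vanish = solve-∀ ℚ-ring
  sumFrom1-linear (suc t) a b f g = begin
    sumFrom1 t (λ i → a * f i - b * g i) + (a * f (suc t) - b * g (suc t))
      ≡⟨ cong (_+ (a * f (suc t) - b * g (suc t))) (sumFrom1-linear t a b f g) ⟩
    a * sumFrom1 t f - b * sumFrom1 t g + (a * f (suc t) - b * g (suc t))
      ≡⟨ regroup a b (sumFrom1 t f) (sumFrom1 t g) (f (suc t)) (g (suc t)) ⟩
    a * (sumFrom1 t f + f (suc t)) - b * (sumFrom1 t g + g (suc t)) ∎
    where
    open ≡-Reasoning
    regroup : ∀ a b floorSum G x y → a * floorSum - b * G + (a * x - b * y) ≡ a * (floorSum + x) - b * (G + y)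
    regroup = solve-∀ ℚ-ring

  sumFrom1-telescope : ∀ t (a : ℕ → ℚ) → sumFrom1 t (λ i → a (i ∸ 1) - a i) ≡ a 0 - a t
  sumFrom1-telescope zero    a = sym (+-inverseʳ (a 0))
  sumFrom1-telescope (suc t) a = trans (cong (_+ (a t - a (suc t))) (sumFrom1-telescope t a)) (cancel (a 0) (a t) (a (suc t)))
    where cancel : ∀ x y z → x - y + (y - z) ≡ x - z
          cancel = solve-∀ ℚ-ring

  sumFin-cong : ∀ k {f g : Fin k → ℚ} → (∀ j → f j ≡ g j) → sumFin k f ≡ sumFin k g
  sumFin-cong zero    f≗g = refl
  sumFin-cong (suc k) f≗g = cong₂ _+_ (f≗g Fin.zero) (sumFin-cong k (λ j → f≗g (Fin.suc j)))

  sumFin-sub : ∀ k (f g : Fin k → ℚ) → sumFin k (λ j → f j - g j) ≡ sumFin k f - sumFin k g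
  sumFin-sub zero    f g = refl
  sumFin-sub (suc k) f g =
    trans (cong (f Fin.zero - g Fin.zero +_) (sumFin-sub k (λ j → f (Fin.suc j)) (λ j → g (Fin.suc j))))
          (regroup (f Fin.zero) (g Fin.zero) _ _)
    where regroup : ∀ x y floorSum G → x - y + (floorSum - G) ≡ x + floorSum - (y + G)
          regroup = solve-∀ ℚ-ring

  sumFin-fromℕ : ∀ k (f : Fin k → ℕ) → sumFin k (λ j → fromℕ (f j)) ≡ fromℕ (sumFinℕ k f)
  sumFin-fromℕ zero    f = refl
  sumFin-fromℕ (suc k) f =
    trans (cong (fromℕ (f Fin.zero) +_) (sumFin-fromℕ k (λ j → f (Fin.suc j)))) (sym (fromℕ-homo-+ (f Fin.zero) _))

  sumFinℕ-cong : ∀ k {f g : Fin k → ℕ} → (∀ j → f j ≡ g j) → sumFinℕ k f ≡ sumFinℕ k g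
  sumFinℕ-cong zero    f≗g = refl
  sumFinℕ-cong (suc k) f≗g = cong₂ ℕ._+_ (f≗g Fin.zero) (sumFinℕ-cong k (λ j → f≗g (Fin.suc j)))

  sumFinℕ-mono : ∀ k {f g : Fin k → ℕ} → (∀ j → f j ℕ.≤ g j) → sumFinℕ k f ℕ.≤ sumFinℕ k g
  sumFinℕ-mono zero    f≤g = z≤n
  sumFinℕ-mono (suc k) f≤g = ℕ.+-mono-≤ (f≤g Fin.zero) (sumFinℕ-mono k (λ j → f≤g (Fin.suc j)))

  sumFinℕ-*ˡ : ∀ k c (f : Fin k → ℕ) → c ℕ.* sumFinℕ k f ≡ sumFinℕ k (λ j → c ℕ.* f j)
  sumFinℕ-*ˡ zero    c f = ℕ.*-zeroʳ c
  sumFinℕ-*ˡ (suc k) c f =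
    trans (ℕ.*-distribˡ-+ c (f Fin.zero) _) (cong (c ℕ.* f Fin.zero ℕ.+_) (sumFinℕ-*ˡ k c (λ j → f (Fin.suc j))))

  sumFinℕ-suc : ∀ k (f : Fin k → ℕ) → sumFinℕ k (λ j → suc (f j)) ≡ k ℕ.+ sumFinℕ k f
  sumFinℕ-suc zero    f = refl
  sumFinℕ-suc (suc k) f = cong suc (begin
    f Fin.zero ℕ.+ sumFinℕ k (λ j → suc (f (Fin.suc j)))  ≡⟨ cong (f Fin.zero ℕ.+_) (sumFinℕ-suc k (λ j → f (Fin.suc j))) ⟩
    f Fin.zero ℕ.+ (k ℕ.+ sumFinℕ k (λ j → f (Fin.suc j))) ≡⟨ x∙yz≈y∙xz (f Fin.zero) k _ ⟩
    k ℕ.+ (f Fin.zero ℕ.+ sumFinℕ k (λ j → f (Fin.suc j))) ∎)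
    where
    open ≡-Reasoning
    open import Algebra.Properties.CommutativeSemigroup ℕ.+-commutativeSemigroup using (x∙yz≈y∙xz)

  sumFinℕ-const : ∀ k c → sumFinℕ k (λ _ → c) ≡ k ℕ.* c
  sumFinℕ-const zero    c = refl
  sumFinℕ-const (suc k) c = cong (c ℕ.+_) (sumFinℕ-const k c)

  abel-inequality : ∀ (a d : ℕ → ℚ) t
    → (∀ s → 1 ℕ.≤ s → s ℕ.< t → a (suc s) ≤ a s)
    → (∀ s → s ℕ.≤ t → 0ℚ ≤ sumFrom1 s d)
    → a t * sumFrom1 t d ≤ sumFrom1 t (λ i → a i * d i)
  abel-inequality a d zero    _ _ = ≤-reflexive (*-zeroʳ (a 0))
  abel-inequality a d (suc t) antitone nonneg = begin
    a (suc t) * (sumFrom1 t d + d (suc t))                ≡⟨ *-distribˡ-+ (a (suc t)) _ _ ⟩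
    a (suc t) * sumFrom1 t d + a (suc t) * d (suc t)      ≤⟨ +-monoˡ-≤ _ (≤-trans (step t ℕ.≤-refl) induction) ⟩
    sumFrom1 t (λ i → a i * d i) + a (suc t) * d (suc t)  ∎
    where
    open ≤-Reasoning
    induction : a t * sumFrom1 t d ≤ sumFrom1 t (λ i → a i * d i)
    induction = abel-inequality a d t (λ s 1≤s s<t → antitone s 1≤s (ℕ.m<n⇒m<1+n s<t)) (λ s s≤t → nonneg s (ℕ.m≤n⇒m≤1+n s≤t))
    step : ∀ s → s ℕ.≤ t → a (suc s) * sumFrom1 s d ≤ a s * sumFrom1 s d
    step zero    _   = ≤-reflexive (trans (*-zeroʳ (a 1)) (sym (*-zeroʳ (a 0))))
    step (suc s) s<t = *-monoʳ-≤-nonNeg (sumFrom1 (suc s) d) {{ℚ.nonNegative (nonneg (suc s) (ℕ.m≤n⇒m≤1+n s<t))}}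
                         (antitone (suc s) (s≤s z≤n) (s≤s s<t))

module Counting where
  open import Level using (Level)
  open import Data.Nat using (ℕ; _*_; _≤_)
  open import Data.Fin using (Fin; zero; suc; combine; remQuot)
  open import Data.Fin.Properties using (injective⇒≤; combine-remQuot; remQuot-combine)
  open import Data.List using (List; _∷_; filter; allFin; length; lookup)
  open import Data.List.Relation.Unary.Unique.Propositional using (Unique)
  open import Data.List.Relation.Unary.Unique.Propositional.Properties using (filter⁺; allFin⁺)
  open import Data.List.Relation.Unary.AllPairs using (_∷_)
  import Data.List.Relation.Unary.All as All
  open import Data.List.Relation.Unary.Any using (index)
  open import Data.List.Relation.Unary.Any.Properties using (lookup-index)
  open import Data.List.Membership.Propositional.Properties using (∈-filter⁺; ∈-filter⁻; ∈-allFin; ∈-lookup)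
  open import Data.Product using (_×_; _,_; proj₁; proj₂; uncurry)
  open import Data.Empty using (⊥-elim)
  open import Function using (Injective; _∘_)
  open import Relation.Unary using (Pred; Decidable)
  open import Relation.Binary.PropositionalEquality

  private variable
    a : Level
    m n : ℕ

  count : {P : Pred (Fin n) a} → Decidable P → ℕ
  count P? = length (filter P? (allFin _))

  lookup-injective : {A : Set a} {xs : List A} → Unique xs → ∀ {i j} → lookup xs i ≡ lookup xs j → i ≡ j
  lookup-injective {xs = x ∷ xs} (x∉xs ∷ u) {zero}  {zero}  eq = refl
  lookup-injective {xs = x ∷ xs} (x∉xs ∷ u) {zero}  {suc j} eq = ⊥-elim (All.lookup x∉xs (∈-lookup j) eq)
  lookup-injective {xs = x ∷ xs} (x∉xs ∷ u) {suc i} {zero}  eq = ⊥-elim (All.lookup x∉xs (∈-lookup i) (sym eq))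
  lookup-injective {xs = x ∷ xs} (x∉xs ∷ u) {suc i} {suc j} eq = cong suc (lookup-injective u eq)

  ×-injective⇒*-≤ : ∀ {a b c d} {h : Fin a × Fin b → Fin c × Fin d} → Injective _≡_ _≡_ h → a * b ≤ c * d
  ×-injective⇒*-≤ {a} {b} {c} {d} {h} h-injective =
    injective⇒≤ {f = uncurry combine ∘ h ∘ remQuot {a} b} (remQuot-injective ∘ h-injective ∘ combine-injective′)
    where
    combine-injective′ : ∀ {x y} → uncurry combine x ≡ uncurry combine y → x ≡ y
    combine-injective′ {x} {y} eq = trans (sym (uncurry remQuot-combine x)) (trans (cong (remQuot {c} d) eq) (uncurry remQuot-combine y))
    remQuot-injective : ∀ {z z′} → remQuot {a} b z ≡ remQuot b z′ → z ≡ z′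
    remQuot-injective {z} {z′} eq = trans (sym (combine-remQuot {a} b z)) (trans (cong (uncurry combine) eq) (combine-remQuot {a} b z′))

  module Members {P : Pred (Fin n) a} (P? : Decidable P) where
    member : Fin (count P?) → Fin n
    member = lookup (filter P? (allFin n))

    member-satisfies : ∀ i → P (member i)
    member-satisfies i = proj₂ (∈-filter⁻ P? {xs = allFin n} (∈-lookup i))

    member-injective : ∀ {i j} → member i ≡ member j → i ≡ j
    member-injective = lookup-injective (filter⁺ P? (allFin⁺ n))

    position : ∀ {x} → P x → Fin (count P?)
    position {x} px = index (∈-filter⁺ P? (∈-allFin x) px)

    member-position : ∀ {x} (px : P x) → member (position px) ≡ x
    member-position {x} px = sym (lookup-index (∈-filter⁺ P? (∈-allFin x) px))

    position-injective : ∀ {x y} (px : P x) (py : P y) → position px ≡ position py → x ≡ y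
    position-injective px py eq = trans (sym (member-position px)) (trans (cong member eq) (member-position py))

  module _ {P : Pred (Fin n) a} (P? : Decidable P) where
    open Members P?

    count-≥ : (g : Fin m → Fin n) → Injective _≡_ _≡_ g → (∀ i → P (g i)) → m ≤ count P?
    count-≥ g g-injective g∈P = injective⇒≤ (g-injective ∘ position-injective (g∈P _) (g∈P _))

    count-≤-1 : (∀ {x y} → P x → P y → x ≡ y) → count P? ≤ 1
    count-≤-1 P-unique = injective⇒≤ {f = λ _ → zero} λ _ → member-injective (P-unique (member-satisfies _) (member-satisfies _))

  module _ {P Q R S : Pred (Fin n) a} (P? : Decidable P) (Q? : Decidable Q) (R? : Decidable R) (S? : Decidable S) where
    private
      module P = Members P?
      module Q = Members Q?
      module R = Members R?
      module S = Members S?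

    count-*-≤ : (f g : Fin n → Fin n → Fin n)
      → (∀ {x y} → P x → Q y → R (f x y)) → (∀ {x y} → P x → Q y → S (g x y))
      → (∀ {x y x′ y′} → P x → Q y → P x′ → Q y′ → f x y ≡ f x′ y′ → g x y ≡ g x′ y′ → x ≡ x′ × y ≡ y′)
      → count P? * count Q? ≤ count R? * count S?
    count-*-≤ f g f∈R g∈S injective = ×-injective⇒*-≤ {h = h} h-injective
      where
      h : Fin (count P?) × Fin (count Q?) → Fin (count R?) × Fin (count S?)
      h (i , j) = R.position (f∈R (P.member-satisfies i) (Q.member-satisfies j))
                , S.position (g∈S (P.member-satisfies i) (Q.member-satisfies j))
      h-injective : Injective _≡_ _≡_ h
      h-injective {i , j} {i′ , j′} eq
        with x≡ , y≡ ← injective (P.member-satisfies i) (Q.member-satisfies j) (P.member-satisfies i′) (Q.member-satisfies j′)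
                         (R.position-injective _ _ (cong proj₁ eq)) (S.position-injective _ _ (cong proj₂ eq))
        = cong₂ _,_ (P.member-injective x≡) (Q.member-injective y≡)

module Multiples {c ℓ} (G : FiniteAbelianGroup c ℓ) where
  open import Data.Nat using (ℕ; zero; suc; _*_; _≤_)
  open import Data.Nat.Properties using (*-comm)
  open import Data.Fin using (Fin; zero; suc)
  open import Data.Product using (_×_; _,_; proj₁; proj₂)
  open import Data.Empty using (⊥-elim)
  open import Relation.Nullary using (yes; no; ¬_)
  open import Relation.Binary.PropositionalEquality as ≡ using (_≡_; _≢_)
  open FiniteAbelianGroup G hiding (card-mult)
  open import Algebra.Properties.AbelianGroup abGroup using (∙-cancelˡ; ∙-cancelʳ; inverseʳ-unique)
  open import Algebra.Properties.CommutativeMonoid.Mult commutativeMonoid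
    using (×-congʳ; ×-congˡ; ×-assocˡ; ×-distrib-+)
    renaming (_×_ to _·_)
  open import Relation.Binary.Reasoning.Setoid setoid
  open Counting

  mulN≡· : ∀ m x → mulN abGroup m x ≡ m · x
  mulN≡· zero    x = ≡.refl
  mulN≡· (suc m) x = ≡.cong (x ∙_) (mulN≡· m x)

  ·-identityʳ : ∀ n → n · ε ≈ ε
  ·-identityʳ zero    = refl
  ·-identityʳ (suc n) = trans (identityˡ _) (·-identityʳ n)

  ·-homo-⁻¹ : ∀ n x → n · (x ⁻¹) ≈ (n · x) ⁻¹
  ·-homo-⁻¹ n x = inverseʳ-unique (n · x) (n · (x ⁻¹)) (begin
    n · x ∙ n · (x ⁻¹)  ≈⟨ ×-distrib-+ x (x ⁻¹) n ⟨
    n · (x ∙ x ⁻¹)      ≈⟨ ×-congʳ n (inverseʳ x) ⟩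
    n · ε               ≈⟨ ·-identityʳ n ⟩
    ε                   ∎)

  ·-distrib-∙⁻¹ : ∀ n x y z → n · (x ∙ (y ∙ z ⁻¹)) ≈ n · x ∙ (n · y ∙ (n · z) ⁻¹)
  ·-distrib-∙⁻¹ n x y z = trans (×-distrib-+ x _ n) (∙-cong refl (trans (×-distrib-+ y _ n) (∙-cong refl (·-homo-⁻¹ n z))))

  ·-·-comm : ∀ m n x → m · (n · x) ≈ (n * m) · x
  ·-·-comm m n x = trans (×-assocˡ x m n) (×-congˡ (*-comm m n))

  index : Carrier → Fin size
  index x = proj₁ (enum-surj x)

  enum-index : ∀ x → enum (index x) ≈ x
  enum-index x = proj₂ (enum-surj x)

  ·-inMultiples : ∀ m y → inMultiples m (index (m · y))
  ·-inMultiples m y = index y , (begin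
    mulN abGroup m (enum (index y)) ≡⟨ mulN≡· m _ ⟩
    m · enum (index y)              ≈⟨ ×-congʳ m (enum-index y) ⟩
    m · y                           ≈⟨ enum-index (m · y) ⟨
    enum (index (m · y))            ∎)

  root : ℕ → Fin size → Carrier
  root m j with inMultiples? m j
  ... | yes (y , _) = enum y
  ... | no _        = ε

  ·-root : ∀ m {j} → inMultiples m j → m · root m j ≈ enum j
  ·-root m {j} j∈mG with inMultiples? m j
  ... | yes (_ , eq) = trans (reflexive (≡.sym (mulN≡· m _))) eq
  ... | no  j∉mG     = ⊥-elim (j∉mG j∈mG)

  card-mult-positive : ∀ m → 1 ≤ card-mult G m
  card-mult-positive m = count-≥ (inMultiples? m) (λ _ → index (m · ε)) (λ { {zero} {zero} _ → ≡.refl }) (λ _ → ·-inMultiples m ε)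

  card-mult-≥-2 : ∀ m x → ¬ (mulN abGroup m x ≈ ε) → 2 ≤ card-mult G m
  card-mult-≥-2 m x mx≉ε = count-≥ (inMultiples? m) g g-injective g∈mG
    where
    g : Fin 2 → Fin size
    g zero    = index (m · ε)
    g (suc _) = index (m · x)
    g∈mG : ∀ i → inMultiples m (g i)
    g∈mG zero    = ·-inMultiples m ε
    g∈mG (suc _) = ·-inMultiples m x
    distinct : index (m · ε) ≢ index (m · x)
    distinct eq = mx≉ε (begin
      mulN abGroup m x     ≡⟨ mulN≡· m x ⟩
      m · x                ≈⟨ enum-index (m · x) ⟨
      enum (index (m · x)) ≡⟨ ≡.cong enum eq ⟨
      enum (index (m · ε)) ≈⟨ enum-index (m · ε) ⟩
      m · ε                ≈⟨ ·-identityʳ m ⟩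
      ε                    ∎)
    g-injective : ∀ {i j} → g i ≡ g j → i ≡ j
    g-injective {zero}        {zero}        _  = ≡.refl
    g-injective {zero}        {suc zero}    eq = ⊥-elim (distinct eq)
    g-injective {suc zero}    {zero}        eq = ⊥-elim (distinct (≡.sym eq))
    g-injective {suc zero}    {suc zero}    _  = ≡.refl

  card-mult-≤-1 : ∀ m → (∀ x → mulN abGroup m x ≈ ε) → card-mult G m ≤ 1
  card-mult-≤-1 m mG≈ε = count-≤-1 (inMultiples? m) λ {j} {j′} (y , y≈) (y′ , y′≈) →
    enum-inj j j′ (trans (sym y≈) (trans (mG≈ε (enum y)) (sym (trans (sym y′≈) (mG≈ε (enum y′))))))

  -- With H = nG this is |pH|² ≤ |H| |p²H|: for x = pn·u x and y = pn·u y in pH, the pair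
  -- (n·(u x + p·u y − p·v y), p²n·u y), where v y is a root of p²n·u y chosen from that element alone,
  -- determines (x, y), since p times the first component is x.
  card-mult-log-concave : ∀ p n → card-mult G (p * n) * card-mult G (p * n) ≤ card-mult G n * card-mult G (p * (p * n))
  card-mult-log-concave p n =
    count-*-≤ (inMultiples? pn) (inMultiples? pn) (inMultiples? n) (inMultiples? ppn)
      first second (λ _ _ → ·-inMultiples n _) (λ _ _ → ·-inMultiples ppn _) injective
    where
    pn ppn : ℕ
    pn  = p * n
    ppn = p * pn
    u : Fin size → Carrier
    u = root pn
    second : Fin size → Fin size → Fin size
    second _ y = index (ppn · u y)
    v : Fin size → Carrier
    v y = root ppn (second y y)
    z : Fin size → Fin size → Carrier
    z x y = u x ∙ (p · u y ∙ (p · v y) ⁻¹)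
    first : Fin size → Fin size → Fin size
    first x y = index (n · z x y)

    ppn·v : ∀ y → ppn · v y ≈ ppn · u y
    ppn·v y = trans (·-root ppn (·-inMultiples ppn (u y))) (enum-index (ppn · u y))

    p·first : ∀ {x} y → inMultiples pn x → p · enum (first x y) ≈ enum x
    p·first {x} y x∈pnG = begin
      p · enum (first x y)                                    ≈⟨ ×-congʳ p (enum-index _) ⟩
      p · (n · z x y)                                         ≈⟨ ×-assocˡ _ p n ⟩
      pn · z x y                                              ≈⟨ ·-distrib-∙⁻¹ pn _ _ _ ⟩
      pn · u x ∙ (pn · (p · u y) ∙ (pn · (p · v y)) ⁻¹)       ≈⟨ ∙-cong (·-root pn x∈pnG) (∙-cong (·-·-comm pn p _) (⁻¹-cong (·-·-comm pn p _))) ⟩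
      enum x ∙ (ppn · u y ∙ (ppn · v y) ⁻¹)                   ≈⟨ ∙-cong refl (∙-cong refl (⁻¹-cong (ppn·v y))) ⟩
      enum x ∙ (ppn · u y ∙ (ppn · u y) ⁻¹)                   ≈⟨ ∙-cong refl (inverseʳ _) ⟩
      enum x ∙ ε                                              ≈⟨ identityʳ _ ⟩
      enum x                                                  ∎

    first-expand : ∀ x {y} → inMultiples pn y → enum (first x y) ≈ n · u x ∙ (enum y ∙ (pn · v y) ⁻¹)
    first-expand x {y} y∈pnG = begin
      enum (first x y)                                        ≈⟨ enum-index _ ⟩
      n · z x y                                               ≈⟨ ·-distrib-∙⁻¹ n _ _ _ ⟩
      n · u x ∙ (n · (p · u y) ∙ (n · (p · v y)) ⁻¹)          ≈⟨ ∙-cong refl (∙-cong (·-·-comm n p _) (⁻¹-cong (·-·-comm n p _))) ⟩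
      n · u x ∙ (pn · u y ∙ (pn · v y) ⁻¹)                    ≈⟨ ∙-cong refl (∙-cong (·-root pn y∈pnG) refl) ⟩
      n · u x ∙ (enum y ∙ (pn · v y) ⁻¹)                      ∎

    injective : ∀ {x y x′ y′} → inMultiples pn x → inMultiples pn y → inMultiples pn x′ → inMultiples pn y′
              → first x y ≡ first x′ y′ → second x y ≡ second x′ y′ → x ≡ x′ × y ≡ y′
    injective {x} {y} {x′} {y′} x∈ y∈ x′∈ y′∈ first≡ second≡ = x≡x′ , y≡y′
      where
      x≡x′ : x ≡ x′
      x≡x′ = enum-inj x x′ (begin
        enum x                  ≈⟨ p·first y x∈ ⟨
        p · enum (first x y)    ≡⟨ ≡.cong (λ i → p · enum i) first≡ ⟩
        p · enum (first x′ y′)  ≈⟨ p·first y′ x′∈ ⟩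
        enum x′                 ∎)
      y≡y′ : y ≡ y′
      y≡y′ = enum-inj y y′ (∙-cancelʳ _ _ _ (∙-cancelˡ _ _ _ (begin
        n · u x ∙ (enum y ∙ (pn · v y) ⁻¹)     ≈⟨ first-expand x y∈ ⟨
        enum (first x y)                       ≡⟨ ≡.cong enum first≡ ⟩
        enum (first x′ y′)                     ≈⟨ first-expand x′ y′∈ ⟩
        n · u x′ ∙ (enum y′ ∙ (pn · v y′) ⁻¹)  ≡⟨ ≡.cong₂ (λ i j → n · u i ∙ (enum y′ ∙ (pn · root ppn j) ⁻¹)) x≡x′ second≡ ⟨
        n · u x ∙ (enum y′ ∙ (pn · v y) ⁻¹)    ∎)))

module Ranks {c ℓ} (G : FiniteAbelianGroup c ℓ) (p e : ℕ) (r : ℕ → ℕ) (ranks : AreRanks G p e r) where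
  open import Data.Nat using (zero; suc; _^_; _∸_; _≤_; _<_; z≤n; s≤s)
  open import Data.Nat.Properties using (<⇒≱; <⇒≤; ≤-refl; ≤-trans; ≤-reflexive; +-identityʳ)
  open import Data.Product using (_,_)
  open import Data.Empty using (⊥-elim)
  open import Relation.Binary.PropositionalEquality using (trans)
  open ℕ-Lemmas using (successive-ratios-≤; ^-cancelʳ-≤)
  open Multiples G

  ranks-antitone : 1 < p → ∀ t → 1 ≤ t → t < e → r (suc t) ≤ r t
  ranks-antitone 1<p (suc t) _ t<e = ^-cancelʳ-≤ 1<p
    (successive-ratios-≤ (ranks (suc t) (s≤s z≤n) (<⇒≤ t<e)) (ranks (suc (suc t)) (s≤s z≤n) t<e)
      (card-mult-positive (p ^ suc t)) (card-mult-positive (p ^ suc (suc t))) (card-mult-log-concave p (p ^ t)))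

  top-rank-positive : 1 ≤ e → HasExponent G p e → 1 ≤ r e
  top-rank-positive 1≤e (pᵉG≈ε , x , pᵉ⁻¹x≉ε) with r e | ranks e 1≤e ≤-refl
  ... | suc _ | _    = s≤s z≤n
  ... | zero  | card≡ =
    ⊥-elim (<⇒≱ (card-mult-≥-2 (p ^ (e ∸ 1)) x pᵉ⁻¹x≉ε)
                (≤-trans (≤-reflexive (trans card≡ (+-identityʳ _))) (card-mult-≤-1 (p ^ e) pᵉG≈ε)))

module EpsilonBound (p e : ℕ) .{{_ : NonZero p}} (k : ℕ) (l : Fin k → ℕ) where
  open import Data.Nat as ℕ using (suc; _^_; _∸_)
  import Data.Nat.Properties as ℕ
  open import Data.Nat.DivMod using (_/_; n/1≡n)
  open import Data.Rational using (ℚ; _+_; _*_; _-_; _≤_; _<_; 0ℚ; 1ℚ)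
  import Data.Rational as ℚ
  open import Data.Rational.Properties using (+-monoˡ-≤; +-monoʳ-≤; *-monoʳ-≤-nonNeg; *-identityˡ; module ≤-Reasoning)
  open import Relation.Binary.PropositionalEquality
  open ℚ-RingSolver
  open import Tactic.RingSolver using (solve-∀)
  open ℚ-Lemmas
  open Sums

  q L : ℕ
  q = p ^ e
  L = sumFinℕ k l

  instance
    q-nonZero : NonZero q
    q-nonZero = ℕ.m^n≢0 p e

  _/p^_ : ℕ → ℕ → ℕ
  x /p^ t = _/_ x (p ^ t) {{ℕ.m^n≢0 p t}}

  floorSum : ℕ → ℕ
  floorSum t = sumFinℕ k (λ j → (l j ∸ 1) /p^ t)

  wSum : ℕ → ℚ
  wSum i = sumFin k (λ j → w p i (l j))

  δ : ℕ → ℚ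
  δ i = inv q * (fromℕ (p ∸ 1) * fromℕ (p ^ (e ∸ i))) - inv L * wSum i

  wSum≡ : ∀ i → wSum i ≡ fromℕ (floorSum (i ∸ 1)) - fromℕ (floorSum i)
  wSum≡ i = begin
    sumFin k (λ j → w p i (l j))
      ≡⟨ sumFin-cong k (λ j → fromℤ-homo-sub (ℤ.+ ((l j ∸ 1) /p^ (i ∸ 1))) (ℤ.+ ((l j ∸ 1) /p^ i))) ⟩
    sumFin k (λ j → fromℕ ((l j ∸ 1) /p^ (i ∸ 1)) - fromℕ ((l j ∸ 1) /p^ i))
      ≡⟨ sumFin-sub k _ _ ⟩
    sumFin k (λ j → fromℕ ((l j ∸ 1) /p^ (i ∸ 1))) - sumFin k (λ j → fromℕ ((l j ∸ 1) /p^ i))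
      ≡⟨ cong₂ _-_ (sumFin-fromℕ k _) (sumFin-fromℕ k _) ⟩
    fromℕ (floorSum (i ∸ 1)) - fromℕ (floorSum i) ∎
    where
    open ≡-Reasoning
    import Data.Integer as ℤ

  sumFrom1-wSum : ∀ t → sumFrom1 t wSum ≡ fromℕ (floorSum 0) - fromℕ (floorSum t)
  sumFrom1-wSum t = trans (sumFrom1-cong t (λ i _ _ → wSum≡ i)) (sumFrom1-telescope t (λ i → fromℕ (floorSum i)))

  geometric-sum : ∀ t → t ℕ.≤ e → sumFrom1 t (λ i → fromℕ (p ∸ 1) * fromℕ (p ^ (e ∸ i))) ≡ fromℕ q - fromℕ (p ^ (e ∸ t))
  geometric-sum t t≤e = begin
    sumFrom1 t (λ i → fromℕ (p ∸ 1) * fromℕ (p ^ (e ∸ i)))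
      ≡⟨ sumFrom1-cong t (λ i 1≤i i≤t → term i 1≤i (ℕ.≤-trans i≤t t≤e)) ⟩
    sumFrom1 t (λ i → fromℕ (p ^ (e ∸ (i ∸ 1))) - fromℕ (p ^ (e ∸ i)))
      ≡⟨ sumFrom1-telescope t (λ i → fromℕ (p ^ (e ∸ i))) ⟩
    fromℕ q - fromℕ (p ^ (e ∸ t)) ∎
    where
    open ≡-Reasoning
    term : ∀ i → 1 ℕ.≤ i → i ℕ.≤ e → fromℕ (p ∸ 1) * fromℕ (p ^ (e ∸ i)) ≡ fromℕ (p ^ (e ∸ (i ∸ 1))) - fromℕ (p ^ (e ∸ i))
    term (suc i) _ i<e = begin
      fromℕ (p ∸ 1) * fromℕ (p ^ (e ∸ suc i))                        ≡⟨ cong (_* fromℕ (p ^ (e ∸ suc i))) (fromℕ-homo-∸ p≥1) ⟩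
      (fromℕ p - 1ℚ) * fromℕ (p ^ (e ∸ suc i))                         ≡⟨ expand (fromℕ p) (fromℕ (p ^ (e ∸ suc i))) ⟩
      fromℕ p * fromℕ (p ^ (e ∸ suc i)) - fromℕ (p ^ (e ∸ suc i))     ≡⟨ cong (_- fromℕ (p ^ (e ∸ suc i))) (fromℕ-homo-* p _) ⟨
      fromℕ (p ^ suc (e ∸ suc i)) - fromℕ (p ^ (e ∸ suc i))           ≡⟨ cong (λ n → fromℕ (p ^ n) - fromℕ (p ^ (e ∸ suc i))) (ℕ.+-∸-assoc 1 i<e) ⟨
      fromℕ (p ^ (e ∸ i)) - fromℕ (p ^ (e ∸ suc i))                   ∎
      where
      expand : ∀ x y → (x - 1ℚ) * y ≡ x * y - y
      expand = solve-∀ ℚ-ring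
      p≥1 : 1 ℕ.≤ p
      p≥1 = ℕ.>-nonZero⁻¹ p

  epsilon-decomposition : ∀ r → epsilon p e r k l ≡ inv q - inv L + sumFrom1 e (λ i → fromℕ (r i) * δ i)
  epsilon-decomposition r = begin
    (1ℚ + P * A) * inv q - (1ℚ + B) * inv L          ≡⟨ rearrange P A B (inv q) (inv L) ⟩
    inv q - inv L + (P * inv q * A - inv L * B)       ≡⟨ cong (inv q - inv L +_) (sumFrom1-linear e (P * inv q) (inv L) _ _) ⟨
    inv q - inv L + sumFrom1 e (λ i → P * inv q * fromℕ (p ^ (e ∸ i) ℕ.* r i) - inv L * (fromℕ (r i) * wSum i))
      ≡⟨ cong (inv q - inv L +_) (sumFrom1-cong e (λ i _ _ → term i)) ⟩
    inv q - inv L + sumFrom1 e (λ i → fromℕ (r i) * δ i) ∎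
    where
    open ≡-Reasoning
    P A B : ℚ
    P = fromℕ (p ∸ 1)
    A = sumFrom1 e (λ i → fromℕ (p ^ (e ∸ i) ℕ.* r i))
    B = sumFrom1 e (λ i → fromℕ (r i) * wSum i)
    rearrange : ∀ P A B i j → (1ℚ + P * A) * i - (1ℚ + B) * j ≡ i - j + (P * i * A - j * B)
    rearrange = solve-∀ ℚ-ring
    distribute : ∀ P i x R j w → P * i * (x * R) - j * (R * w) ≡ R * (i * (P * x) - j * w)
    distribute = solve-∀ ℚ-ring
    term : ∀ i → P * inv q * fromℕ (p ^ (e ∸ i) ℕ.* r i) - inv L * (fromℕ (r i) * wSum i) ≡ fromℕ (r i) * δ i
    term i = trans (cong (λ x → P * inv q * x - inv L * (fromℕ (r i) * wSum i)) (fromℕ-homo-* (p ^ (e ∸ i)) (r i)))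
                   (distribute P (inv q) (fromℕ (p ^ (e ∸ i))) (fromℕ (r i)) (inv L) (wSum i))

  module _ (l≥1 : ∀ j → 1 ℕ.≤ l j) .{{_ : NonZero L}} where
    open ℕ-Lemmas

    L≡k+floorSum0 : L ≡ k ℕ.+ floorSum 0
    L≡k+floorSum0 = trans (sumFinℕ-cong k (λ j → trans (sym (suc[n∸1]≡n (l≥1 j))) (cong suc (sym (n/1≡n (l j ∸ 1))))))
                   (sumFinℕ-suc k (λ j → (l j ∸ 1) /p^ 0))

    partial-sum-δ : ∀ t → t ℕ.≤ e → sumFrom1 t δ ≡ fromℕ (k ℕ.+ floorSum t) * inv L - fromℕ (p ^ (e ∸ t)) * inv q
    partial-sum-δ t t≤e = begin
      sumFrom1 t δ
        ≡⟨ sumFrom1-linear t (inv q) (inv L) _ wSum ⟩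
      inv q * sumFrom1 t (λ i → fromℕ (p ∸ 1) * fromℕ (p ^ (e ∸ i))) - inv L * sumFrom1 t wSum
        ≡⟨ cong₂ (λ a b → inv q * a - inv L * b) (geometric-sum t t≤e) (sumFrom1-wSum t) ⟩
      inv q * (fromℕ q - X) - inv L * (fromℕ (floorSum 0) - fromℕ (floorSum t))
        ≡⟨ expand (inv q) (fromℕ q) X (inv L) (fromℕ k) (fromℕ (floorSum 0)) (fromℕ (floorSum t)) ⟩
      fromℕ q * inv q - X * inv q - (fromℕ k + fromℕ (floorSum 0)) * inv L + (fromℕ k + fromℕ (floorSum t)) * inv L
        ≡⟨ cong₂ (λ a b → a - X * inv q - b + (fromℕ k + fromℕ (floorSum t)) * inv L) (fromℕ*inv≡1 q) L*inv≡1 ⟩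
      1ℚ - X * inv q - 1ℚ + (fromℕ k + fromℕ (floorSum t)) * inv L
        ≡⟨ simplify (X * inv q) ((fromℕ k + fromℕ (floorSum t)) * inv L) ⟩
      (fromℕ k + fromℕ (floorSum t)) * inv L - X * inv q
        ≡⟨ cong (λ a → a * inv L - X * inv q) (fromℕ-homo-+ k (floorSum t)) ⟨
      fromℕ (k ℕ.+ floorSum t) * inv L - X * inv q ∎
      where
      open ≡-Reasoning
      X : ℚ
      X = fromℕ (p ^ (e ∸ t))
      L*inv≡1 : (fromℕ k + fromℕ (floorSum 0)) * inv L ≡ 1ℚ
      L*inv≡1 = trans (cong (λ n → n * inv L) (trans (sym (fromℕ-homo-+ k (floorSum 0))) (cong fromℕ (sym L≡k+floorSum0)))) (fromℕ*inv≡1 L)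
      expand : ∀ i Q X j K F₀ Fₜ → i * (Q - X) - j * (F₀ - Fₜ) ≡ Q * i - X * i - (K + F₀) * j + (K + Fₜ) * j
      expand = solve-∀ ℚ-ring
      simplify : ∀ x y → 1ℚ - x - 1ℚ + y ≡ y - x
      simplify = solve-∀ ℚ-ring

    scaled-length-bound : ∀ t → t ℕ.≤ e → p ^ (e ∸ t) ℕ.* L ℕ.≤ (k ℕ.+ floorSum t) ℕ.* q
    scaled-length-bound t t≤e = begin
      p ^ (e ∸ t) ℕ.* L                                    ≡⟨ sumFinℕ-*ˡ k (p ^ (e ∸ t)) l ⟩
      sumFinℕ k (λ j → p ^ (e ∸ t) ℕ.* l j)                ≤⟨ sumFinℕ-mono k term ⟩
      sumFinℕ k (λ j → q ℕ.* suc ((l j ∸ 1) /p^ t))        ≡⟨ sumFinℕ-*ˡ k q _ ⟨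
      q ℕ.* sumFinℕ k (λ j → suc ((l j ∸ 1) /p^ t))        ≡⟨ cong (q ℕ.*_) (sumFinℕ-suc k _) ⟩
      q ℕ.* (k ℕ.+ floorSum t)                                    ≡⟨ ℕ.*-comm q _ ⟩
      (k ℕ.+ floorSum t) ℕ.* q                                    ∎
      where
      open ℕ.≤-Reasoning
      q≡ : q ≡ p ^ (e ∸ t) ℕ.* p ^ t
      q≡ = trans (cong (p ^_) (sym (ℕ.m∸n+n≡m t≤e))) (ℕ.^-distribˡ-+-* p (e ∸ t) t)
      term : ∀ j → p ^ (e ∸ t) ℕ.* l j ℕ.≤ q ℕ.* suc ((l j ∸ 1) /p^ t)
      term j = begin
        p ^ (e ∸ t) ℕ.* l j                                ≤⟨ ℕ.*-monoʳ-≤ (p ^ (e ∸ t)) l≤ ⟩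
        p ^ (e ∸ t) ℕ.* (p ^ t ℕ.* suc ((l j ∸ 1) /p^ t))  ≡⟨ ℕ.*-assoc (p ^ (e ∸ t)) _ _ ⟨
        p ^ (e ∸ t) ℕ.* p ^ t ℕ.* suc ((l j ∸ 1) /p^ t)    ≡⟨ cong (ℕ._* suc ((l j ∸ 1) /p^ t)) q≡ ⟨
        q ℕ.* suc ((l j ∸ 1) /p^ t)                        ∎
        where
        l≤ : l j ℕ.≤ p ^ t ℕ.* suc ((l j ∸ 1) /p^ t)
        l≤ = subst (ℕ._≤ p ^ t ℕ.* suc ((l j ∸ 1) /p^ t)) (suc[n∸1]≡n (l≥1 j)) (m<n*[1+m/n] (l j ∸ 1) (p ^ t) {{ℕ.m^n≢0 p t}})

    partial-sum-δ-nonneg : ∀ t → t ℕ.≤ e → 0ℚ ≤ sumFrom1 t δ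
    partial-sum-δ-nonneg t t≤e = subst (0ℚ ≤_) (sym (partial-sum-δ t t≤e))
      (p≤q⇒0≤q-p (fromℕ*inv-≤ (p ^ (e ∸ t)) (k ℕ.+ floorSum t) q L (scaled-length-bound t t≤e)))

    total-sum-δ-≥ : fromℕ k * inv L - inv q ≤ sumFrom1 e δ
    total-sum-δ-≥ = begin
      fromℕ k * inv L - inv q                  ≤⟨ +-monoˡ-≤ (ℚ.- inv q) k/L≤K/L ⟩
      K * inv L - inv q                        ≡⟨ cong (K * inv L -_) (*-identityˡ (inv q)) ⟨
      K * inv L - 1ℚ * inv q                   ≡⟨ cong (λ n → K * inv L - fromℕ (p ^ n) * inv q) (ℕ.n∸n≡0 e) ⟨
      K * inv L - fromℕ (p ^ (e ∸ e)) * inv q  ≡⟨ partial-sum-δ e ℕ.≤-refl ⟨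
      sumFrom1 e δ                             ∎
      where
      open ≤-Reasoning
      K : ℚ
      K = fromℕ (k ℕ.+ floorSum e)
      k/L≤K/L : fromℕ k * inv L ≤ K * inv L
      k/L≤K/L = fromℕ*inv-≤ k (k ℕ.+ floorSum e) L L (ℕ.*-monoˡ-≤ L (ℕ.m≤m+n k (floorSum e)))

    epsilon-lower-bound : ∀ r → 1 ℕ.≤ k → (∀ s → 1 ℕ.≤ s → s ℕ.< e → r (suc s) ℕ.≤ r s) → 1 ℕ.≤ r e
      → fromℕ (k ∸ 1) * inv L ≤ epsilon p e r k l
    epsilon-lower-bound r 1≤k r-antitone 1≤rₑ = begin
      fromℕ (k ∸ 1) * inv L                                  ≡⟨ cong (_* inv L) (fromℕ-homo-∸ 1≤k) ⟩
      (fromℕ k - 1ℚ) * inv L                                 ≡⟨ regroup (fromℕ k) (inv q) (inv L) ⟩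
      inv q - inv L + (fromℕ k * inv L - inv q)              ≤⟨ +-monoʳ-≤ (inv q - inv L) total-sum-δ-≥ ⟩
      inv q - inv L + sumFrom1 e δ                           ≡⟨ cong (inv q - inv L +_) (*-identityˡ _) ⟨
      inv q - inv L + 1ℚ * sumFrom1 e δ                      ≤⟨ +-monoʳ-≤ (inv q - inv L) Sₑ≤rₑSₑ ⟩
      inv q - inv L + fromℕ (r e) * sumFrom1 e δ             ≤⟨ +-monoʳ-≤ (inv q - inv L) abel ⟩
      inv q - inv L + sumFrom1 e (λ i → fromℕ (r i) * δ i)   ≡⟨ epsilon-decomposition r ⟨
      epsilon p e r k l                                      ∎
      where
      open ≤-Reasoning
      regroup : ∀ K i j → (K - 1ℚ) * j ≡ i - j + (K * j - i)
      regroup = solve-∀ ℚ-ring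
      Sₑ≤rₑSₑ : 1ℚ * sumFrom1 e δ ≤ fromℕ (r e) * sumFrom1 e δ
      Sₑ≤rₑSₑ = *-monoʳ-≤-nonNeg (sumFrom1 e δ) {{ℚ.nonNegative (partial-sum-δ-nonneg e ℕ.≤-refl)}} (fromℕ-mono-≤ 1≤rₑ)
      abel : fromℕ (r e) * sumFrom1 e δ ≤ sumFrom1 e (λ i → fromℕ (r i) * δ i)
      abel = abel-inequality (λ i → fromℕ (r i)) δ e (λ s 1≤s s<e → fromℕ-mono-≤ (r-antitone s 1≤s s<e)) partial-sum-δ-nonneg

  inv[2q]<[k∸1]*inv[L] : .{{_ : NonZero L}} → 2 ℕ.≤ k → (∀ j → l j ℕ.≤ q ∸ 1) → inv (2 ℕ.* q) < fromℕ (k ∸ 1) * inv L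
  inv[2q]<[k∸1]*inv[L] 2≤k l≤q-1 = begin-strict
    inv (2 ℕ.* q)               ≡⟨ *-identityˡ _ ⟨
    1ℚ * inv (2 ℕ.* q)          <⟨ fromℕ*inv-< 1 (k ∸ 1) (2 ℕ.* q) L {{ℕ.m*n≢0 2 q}} (ℕ.≤-<-trans (ℕ.≤-reflexive (ℕ.*-identityˡ L)) L<) ⟩
    fromℕ (k ∸ 1) * inv L       ∎
    where
    open ≤-Reasoning
    open ℕ-Lemmas
    L< : L ℕ.< (k ∸ 1) ℕ.* (2 ℕ.* q)
    L< = ℕ.≤-<-trans (ℕ.≤-trans (sumFinℕ-mono k l≤q-1) (ℕ.≤-reflexive (sumFinℕ-const k (q ∸ 1))))
                    (m*[n∸1]<[m∸1]*[2*n] k q 2≤k (ℕ.>-nonZero⁻¹ q))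

open import Data.Nat using (_≤_; _^_; _∸_; _*_)
open import Data.Nat.Primality using (Prime)
open import Data.Product using (_×_)
open import Data.Rational using (_<_)

open import Data.Nat as ℕ using (suc; >-nonZero; nonTrivial⇒n>1)
open import Data.Nat.Properties using (<⇒≤; ≤-trans; m≤m+n)
open import Data.Nat.Primality using (prime⇒nonTrivial)
open import Data.Product using (proj₁; proj₂)
import Data.Rational as ℚ
open import Data.Rational.Properties using (module ≤-Reasoning)
open import Function using (_∘_)

proposition6p6 : ∀ {c ℓ : Level} (G : FiniteAbelianGroup c ℓ) (p e : ℕ) .{{_ : NonZero p}}
    → Prime p → 1 ≤ e → HasExponent G p e
    → (r : ℕ → ℕ) → AreRanks G p e r
    → (k : ℕ) → 2 ≤ k → (l : Fin k → ℕ) → (∀ j → 1 ≤ l j × l j ≤ p ^ e ∸ 1)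
    → inv (2 * p ^ e) < epsilon p e r k l
proposition6p6 G p e p-prime 1≤e exponent r ranks k@(suc _) 2≤k l bounds = begin-strict
  inv (2 * p ^ e)         <⟨ inv[2q]<[k∸1]*inv[L] 2≤k (proj₂ ∘ bounds) ⟩
  fromℕ (k ∸ 1) ℚ.* inv L ≤⟨ epsilon-lower-bound (proj₁ ∘ bounds) r (<⇒≤ 2≤k) r-antitone (top-rank-positive 1≤e exponent) ⟩
  epsilon p e r k l       ∎
  where
  open ≤-Reasoning
  open EpsilonBound p e k l
  open Ranks G p e r ranks
  r-antitone : ∀ s → 1 ≤ s → s ℕ.< e → r (suc s) ≤ r s
  r-antitone = ranks-antitone (nonTrivial⇒n>1 p {{prime⇒nonTrivial p-prime}})
  instance
    L-nonZero : NonZero L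
    L-nonZero = >-nonZero (≤-trans (proj₁ (bounds Data.Fin.zero)) (m≤m+n _ _))
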